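{- Let $(G,\omega,t,w)$ be an instance of Secluded Clique and let $H$ be a solution (a $t$-secluded clique in $G$ with $\omega(V(H))\ge w$) such that $V(H)$ is inclusion-maximal among solutions. Let $L$ be an inclusion-maximal set of pairwise true twins of $G$. Then $L\cap V(H)\neq\emptyset$ implies $L\subseteq V(H)$.
   Context: All graphs are finite, simple, undirected. For $U\subseteq V(G)$, $N_G(U)=\left(\bigcup_{v\in U}N_G(v)\right)\setminus U$; an induced subgraph $H$ is $t$-secluded if $|N_G(V(H))|\le t$. Secluded Clique: given $G$, $\omega\colon V(G)\to\mathbb{Z}_{>0}$, a nonnegative integer $t$ and a positive integer $w$, decide whether $G$ contains a $t$-secluded clique $H$ with $\omega(V(H))=\sum_{v\in V(H)}\omega(v)\ge w$; a solution is such an $H$. Vertices $u,v$ are true twins if $N_G[u]=N_G[v]$, where $N_G[v]=N_G(v)\cup\{v\}$. -}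

module Defs where

open import Data.Nat using (ℕ; _≤_; _+_)
open import Data.Bool using (Bool; true; false; if_then_else_; _∧_; not)
open import Data.Fin using (Fin)
open import Data.Fin.Properties using (any?)
open import Data.Fin.Subset using (Subset; _∈_; _∉_; _⊆_; _∩_; Nonempty; ∣_∣)
open import Data.Fin.Subset.Properties using (_∈?_)
open import Data.Vec using (tabulate)
open import Data.Vec.Functional using () renaming (foldr to foldrF)
open import Data.Product using (Σ; _×_; _,_)
open import Data.Sum using (_⊎_)
open import Relation.Binary.PropositionalEquality using (_≡_; _≢_)
open import Relation.Nullary using (¬_)
open import Relation.Nullary.Decidable using (⌊_⌋; _×-dec_)
open import Function.Bundles using (_⇔_)

record Graph (n : ℕ) : Set where
  field
    adj   : Fin n → Fin n → Bool
    sym   : ∀ u v → adj u v ≡ adj v u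
    irrefl : ∀ v → adj v v ≡ false

open Graph public

module _ {n : ℕ} (G : Graph n) where

  adjToSet : Subset n → Fin n → Bool
  adjToSet U v = ⌊ any? (λ u → (u ∈? U) ×-dec (Data.Bool._≟_ (adj G u v) true)) ⌋

  nbhd : Subset n → Subset n
  nbhd U = tabulate (λ v → adjToSet U v ∧ not ⌊ v ∈? U ⌋)

  IsClique : Subset n → Set
  IsClique U = ∀ u v → u ∈ U → v ∈ U → u ≢ v → adj G u v ≡ true

  Secluded : ℕ → Subset n → Set
  Secluded t U = ∣ nbhd U ∣ ≤ t

  TrueTwins : Fin n → Fin n → Set
  TrueTwins u v = ∀ x → ((x ≡ u ⊎ adj G u x ≡ true) ⇔ (x ≡ v ⊎ adj G v x ≡ true))

  PairwiseTrueTwins : Subset n → Set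
  PairwiseTrueTwins L = ∀ u v → u ∈ L → v ∈ L → TrueTwins u v

  MaximalTwinSet : Subset n → Set
  MaximalTwinSet L = PairwiseTrueTwins L × (∀ L′ → PairwiseTrueTwins L′ → L ⊆ L′ → L′ ⊆ L)

weight : {n : ℕ} → (Fin n → ℕ) → Subset n → ℕ
weight ω U = foldrF _+_ 0 (λ v → if ⌊ v ∈? U ⌋ then ω v else 0)

module _ {n : ℕ} (G : Graph n) (ω : Fin n → ℕ) (t w : ℕ) where

  IsSolution : Subset n → Set
  IsSolution U = IsClique G U × Secluded G t U × w ≤ weight ω U

  MaximalSolution : Subset n → Set
  MaximalSolution U = IsSolution U × (∀ U′ → IsSolution U′ → U ⊆ U′ → U′ ⊆ U)

-- A true twin y of a vertex x of a clique H is adjacent to all of H ∖ {y}, and every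
-- neighbour of y outside H ∪ {y} is already a neighbour of x.  Hence H ∪ {y} is again a
-- clique, its neighbourhood is contained in that of H, and its weight is at least that
-- of H: it is a solution, so maximality of H forces y ∈ H.
module Submission where

open import Defs hiding (sym)
open import Data.Nat using (ℕ; zero; suc; _>_; _≤_; _+_; z≤n)
open import Data.Nat.Properties using (+-mono-≤; ≤-refl; ≤-trans)
open import Data.Fin using (Fin; _≟_)
open import Data.Fin.Subset using (Subset; _⊆_; _∩_; _∪_; ⁅_⁆; Nonempty; _∈_; _∉_)
open import Data.Fin.Subset.Properties
  using (_∈?_; p⊆p∪q; x∈p∪q⁺; x∈p∪q⁻; x∈⁅x⁆; x∈⁅y⁆⇒x≡y; x∈p∩q⁻; p⊆q⇒∣p∣≤∣q∣)
open import Data.Bool using (Bool; true; if_then_else_)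
open import Data.Bool.Properties using (T-≡; T-∧)
open import Data.Vec using (tabulate)
open import Data.Vec.Properties using (lookup∘tabulate; lookup⇒[]=; []=⇒lookup)
open import Data.Vec.Functional using () renaming (foldr to foldrF)
open import Data.Product using (∃; _×_; _,_)
open import Data.Sum using (_⊎_; inj₁; inj₂)
open import Data.Empty using (⊥-elim)
open import Function using (_∘_)
open import Relation.Binary.PropositionalEquality using (_≡_; _≢_; refl; trans; sym)
open import Relation.Nullary using (yes; no)
open import Relation.Nullary.Decidable using (⌊_⌋; toWitness; fromWitness; toWitnessFalse; fromWitnessFalse)
open import Function.Bundles using (Equivalence)
open Equivalence using (to; from)
import Function.Properties.Equivalence as ⇔

∈-tabulate⁻ : ∀ {n} (f : Fin n → Bool) {v} → v ∈ tabulate f → f v ≡ true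
∈-tabulate⁻ f {v} v∈ = trans (sym (lookup∘tabulate f v)) ([]=⇒lookup v∈)

∈-tabulate⁺ : ∀ {n} (f : Fin n → Bool) {v} → f v ≡ true → v ∈ tabulate f
∈-tabulate⁺ f {v} fv = lookup⇒[]= v (tabulate f) (trans (lookup∘tabulate f v) fv)

foldr-+-mono-≤ : ∀ {n} (f g : Fin n → ℕ) → (∀ i → f i ≤ g i) → foldrF _+_ 0 f ≤ foldrF _+_ 0 g
foldr-+-mono-≤ {zero}  f g f≤g = z≤n
foldr-+-mono-≤ {suc n} f g f≤g =
  +-mono-≤ (f≤g Fin.zero) (foldr-+-mono-≤ (λ i → f (Fin.suc i)) (λ i → g (Fin.suc i)) (λ i → f≤g (Fin.suc i)))
  where import Data.Fin as Fin

weight-mono : ∀ {n} (ω : Fin n → ℕ) {U V : Subset n} → U ⊆ V → weight ω U ≤ weight ω V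
weight-mono ω {U} {V} U⊆V = foldr-+-mono-≤ _ _ summand-mono
  where
  summand-mono : ∀ i → (if ⌊ i ∈? U ⌋ then ω i else 0) ≤ (if ⌊ i ∈? V ⌋ then ω i else 0)
  summand-mono i with i ∈? U | i ∈? V
  ... | yes _   | yes _   = ≤-refl
  ... | yes i∈U | no i∉V  = ⊥-elim (i∉V (U⊆V i∈U))
  ... | no _    | _       = z≤n

∈-∪⁅⁆⁻ : ∀ {n} {U : Subset n} {y u : Fin n} → u ∈ U ∪ ⁅ y ⁆ → u ∈ U ⊎ u ≡ y
∈-∪⁅⁆⁻ {U = U} {y} u∈ with x∈p∪q⁻ U ⁅ y ⁆ u∈
... | inj₁ u∈U = inj₁ u∈U
... | inj₂ u∈y = inj₂ (x∈⁅y⁆⇒x≡y y u∈y)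

module _ {n : ℕ} (G : Graph n) where

  ∈-nbhd⁻ : ∀ {U v} → v ∈ nbhd G U → ∃ (λ u → u ∈ U × adj G u v ≡ true) × v ∉ U
  ∈-nbhd⁻ {U} {v} v∈ with to (T-∧ {adjToSet G U v}) (from T-≡ (∈-tabulate⁻ _ v∈))
  ... | adjacent , outside = toWitness adjacent , toWitnessFalse outside

  ∈-nbhd⁺ : ∀ {U u v} → u ∈ U → adj G u v ≡ true → v ∉ U → v ∈ nbhd G U
  ∈-nbhd⁺ {U} {u} {v} u∈U uv v∉U =
    ∈-tabulate⁺ _ (to T-≡ (from (T-∧ {adjToSet G U v})
      ( fromWitness (u , u∈U , uv)
      , fromWitnessFalse v∉U)))

  TrueTwins-sym : ∀ {x y} → TrueTwins G x y → TrueTwins G y x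
  TrueTwins-sym x~y v = ⇔.sym (x~y v)

  twin-adjacent : ∀ {x y v} → TrueTwins G x y → v ≡ x ⊎ adj G x v ≡ true → v ≢ y → adj G y v ≡ true
  twin-adjacent x~y v∈N[x] v≢y with to (x~y _) v∈N[x]
  ... | inj₁ v≡y = ⊥-elim (v≢y v≡y)
  ... | inj₂ yv  = yv

  twin-adjacent-clique : ∀ {U x y} → IsClique G U → x ∈ U → TrueTwins G x y →
                         ∀ v → v ∈ U → v ≢ y → adj G y v ≡ true
  twin-adjacent-clique {x = x} U-clique x∈U x~y v v∈U = twin-adjacent x~y v∈N[x]
    where
    v∈N[x] : v ≡ x ⊎ adj G x v ≡ true
    v∈N[x] with v ≟ x
    ... | yes v≡x = inj₁ v≡x
    ... | no v≢x  = inj₂ (U-clique x v x∈U v∈U (v≢x ∘ sym))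

  clique-∪⁅⁆ : ∀ {U y} → IsClique G U → (∀ v → v ∈ U → v ≢ y → adj G y v ≡ true) →
               IsClique G (U ∪ ⁅ y ⁆)
  clique-∪⁅⁆ U-clique y-adj u v u∈ v∈ u≢v with ∈-∪⁅⁆⁻ u∈ | ∈-∪⁅⁆⁻ v∈
  ... | inj₁ u∈U  | inj₁ v∈U  = U-clique u v u∈U v∈U u≢v
  ... | inj₁ u∈U  | inj₂ refl = trans (Graph.sym G u v) (y-adj u u∈U u≢v)
  ... | inj₂ refl | inj₁ v∈U  = y-adj v v∈U (u≢v ∘ sym)
  ... | inj₂ refl | inj₂ refl = ⊥-elim (u≢v refl)

  nbhd-∪⁅twin⁆⊆nbhd : ∀ {U x y} → x ∈ U → TrueTwins G y x → nbhd G (U ∪ ⁅ y ⁆) ⊆ nbhd G U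
  nbhd-∪⁅twin⁆⊆nbhd {x = x} {y} x∈U y~x {v} v∈ with ∈-nbhd⁻ v∈
  ... | (u , u∈ , uv) , v∉ with ∈-∪⁅⁆⁻ u∈
  ... | inj₁ u∈U  = ∈-nbhd⁺ u∈U uv (v∉ ∘ p⊆p∪q ⁅ y ⁆)
  ... | inj₂ refl = ∈-nbhd⁺ x∈U (twin-adjacent y~x (inj₂ uv) v≢x) (v∉ ∘ p⊆p∪q ⁅ y ⁆)
    where
    v≢x : v ≢ x
    v≢x refl = v∉ (p⊆p∪q ⁅ y ⁆ x∈U)

module _ {n : ℕ} (G : Graph n) (ω : Fin n → ℕ) (t w : ℕ) where

  solution-∪⁅twin⁆ : ∀ {U x y} → IsSolution G ω t w U → x ∈ U → TrueTwins G x y →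
                     IsSolution G ω t w (U ∪ ⁅ y ⁆)
  solution-∪⁅twin⁆ {y = y} (U-clique , U-secluded , U-heavy) x∈U x~y =
      clique-∪⁅⁆ G U-clique (twin-adjacent-clique G U-clique x∈U x~y)
    , ≤-trans (p⊆q⇒∣p∣≤∣q∣ (nbhd-∪⁅twin⁆⊆nbhd G x∈U (TrueTwins-sym G x~y))) U-secluded
    , ≤-trans U-heavy (weight-mono ω (p⊆p∪q ⁅ y ⁆))

mainTheorem12 : (n : ℕ) (G : Graph n) (ω : Fin n → ℕ) → (∀ v → ω v > 0) →
    (t w : ℕ) → w > 0 → (H L : Subset n) →
    MaximalSolution G ω t w H → MaximalTwinSet G L →
    Nonempty (L ∩ H) → L ⊆ H
mainTheorem12 n G ω _ t w _ H L (H-solution , H-maximal) (L-twins , _) (x , x∈L∩H) {y} y∈L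
  with x∈p∩q⁻ L H x∈L∩H
... | x∈L , x∈H = H-maximal (H ∪ ⁅ y ⁆) H∪y-solution (p⊆p∪q ⁅ y ⁆) (x∈p∪q⁺ (inj₂ (x∈⁅x⁆ y)))
  where
  H∪y-solution : IsSolution G ω t w (H ∪ ⁅ y ⁆)
  H∪y-solution = solution-∪⁅twin⁆ G ω t w H-solution x∈H (L-twins x y x∈L y∈L)
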